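{- Let $L \in \mathbb{Q}$ and let $E_L$ be the curve $y^2 = x(x-1)(x-L)$. Then $E_L$ is a nice elliptic curve if and only if \[L = \frac{s^2-1}{2s-1}\] for some $s \in \mathbb{Q} \setminus \{0, 1/2, 2, 1, -1\}$.
   Context: For $L \in \mathbb{Q}$, the curve $E_L: y^2 = x(x-1)(x-L)$ is called a nice elliptic curve if $L \in \mathbb{Q}\setminus\{0,1\}$ and $L^2 - L + 1$ is the square of a rational number (equivalently, $f_L(x) = x(x-1)(x-L)$ has distinct roots and its derivative $f_L'(x)$ splits into linear factors over $\mathbb{Q}$). -}

module Defs where

open import Data.Integer using (+_)
open import Data.Rational
open import Data.Rational.Properties using (+-identityˡ; +-identityʳ; +-inverseˡ; +-assoc; *-identityˡ; *-identityʳ; *-assoc)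
open import Data.Product using (∃; _×_)
open import Relation.Binary.PropositionalEquality
open import Relation.Nullary using (¬_)

2ℚ : ℚ
2ℚ = 1ℚ + 1ℚ

½ℚ : ℚ
½ℚ = + 1 / 2

-- f_L(x) = x (x - 1) (x - L);  E_L : y^2 = f_L(x)
-- E_L is a "nice elliptic curve": L ∉ {0,1} and L^2 - L + 1 is a square in ℚ
NiceEllipticCurve : ℚ → Set
NiceEllipticCurve L =
  (L ≢ 0ℚ) × (L ≢ 1ℚ) × ∃ λ r → L * L - L + 1ℚ ≡ r * r

2s-1≢0 : ∀ s → s ≢ ½ℚ → 2ℚ * s - 1ℚ ≢ 0ℚ
2s-1≢0 s s≢½ e = s≢½ lemma
  where
  open ≡-Reasoning
  e2 : 2ℚ * s ≡ 1ℚ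
  e2 = begin
    2ℚ * s                       ≡⟨ sym (+-identityʳ _) ⟩
    2ℚ * s + 0ℚ                  ≡⟨ cong (λ z → 2ℚ * s + z) (sym (+-inverseˡ 1ℚ)) ⟩
    2ℚ * s + (- 1ℚ + 1ℚ)         ≡⟨ sym (+-assoc (2ℚ * s) (- 1ℚ) 1ℚ) ⟩
    (2ℚ * s - 1ℚ) + 1ℚ           ≡⟨ cong (_+ 1ℚ) e ⟩
    0ℚ + 1ℚ                      ≡⟨ +-identityˡ 1ℚ ⟩
    1ℚ ∎
  lemma : s ≡ ½ℚ
  lemma = begin
    s                 ≡⟨ sym (*-identityˡ s) ⟩
    1ℚ * s            ≡⟨ cong (_* s) (refl {x = ½ℚ * 2ℚ}) ⟩
    (½ℚ * 2ℚ) * s     ≡⟨ *-assoc ½ℚ 2ℚ s ⟩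
    ½ℚ * (2ℚ * s)     ≡⟨ cong (λ z → ½ℚ * z) e2 ⟩
    ½ℚ * 1ℚ           ≡⟨ *-identityʳ ½ℚ ⟩
    ½ℚ ∎

formula : (s : ℚ) → s ≢ ½ℚ → ℚ
formula s s≢½ = (s * s - 1ℚ) ÷ (2ℚ * s - 1ℚ)
  where instance _ = ≢-nonZero (2s-1≢0 s s≢½)

-- Writing s = L + r, the identity
--   L (2s − 1) − (s² − 1) = (L² − L + 1) − (s − L)²
-- shows that L² − L + 1 = r² exactly when L (2s − 1) = s² − 1, i.e. L = (s² − 1)/(2s − 1).
-- Under this relation L = 0 iff s² = 1 and L = 1 iff s² − 2s = 0, which accounts for the
-- excluded values of s, while s = 1/2 is impossible since it would force 0 = −3/4.
{-# OPTIONS --safe #-}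
module Submission where

open import Defs
open import Data.Rational using (ℚ; 0ℚ; 1ℚ; _+_; _*_; _-_; -_; 1/_; _÷_; ≢-nonZero)
open import Data.Rational.Properties
  using (_≟_; +-0-group; heytingCommutativeRing; *-assoc; *-identityʳ; *-inverseˡ; *-inverseʳ; *-zeroˡ; *-zeroʳ)
open import Data.Rational.Solver using (module +-*-Solver)
open import Data.Empty using (⊥-elim)
open import Data.Product using (Σ; ∃; _×_; _,_)
open import Data.Sum using (_⊎_; inj₁; inj₂; [_,_])
open import Function using (_∘_)
open import Function.Bundles using (_⇔_; mk⇔; Equivalence)
open import Function.Construct.Composition using (_⇔-∘_)
open import Relation.Binary.PropositionalEquality using (_≡_; _≢_; refl; sym; trans; cong; module ≡-Reasoning)
open import Relation.Nullary using (yes; no)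
open import Algebra.Properties.Group +-0-group using (x∙y⁻¹≈ε⇒x≈y; x≈y⇒x∙y⁻¹≈ε)
open import Algebra.Apartness.Properties.HeytingCommutativeRing heytingCommutativeRing
  using (x#0y#0→xy#0)

open +-*-Solver
open Equivalence using (to; from)
open ≡-Reasoning

a-b≡c-d⇒[a≡b⇔c≡d] : ∀ {a b c d} → a - b ≡ c - d → (a ≡ b ⇔ c ≡ d)
a-b≡c-d⇒[a≡b⇔c≡d] {a} {b} {c} {d} eq = mk⇔
  (λ a≡b → x∙y⁻¹≈ε⇒x≈y c d (trans (sym eq) (x≈y⇒x∙y⁻¹≈ε a≡b)))
  (λ c≡d → x∙y⁻¹≈ε⇒x≈y a b (trans eq (x≈y⇒x∙y⁻¹≈ε c≡d)))

*≡0⇒≡0⊎≡0 : ∀ p q → p * q ≡ 0ℚ → p ≡ 0ℚ ⊎ q ≡ 0ℚ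
*≡0⇒≡0⊎≡0 p q pq≡0 with p ≟ 0ℚ | q ≟ 0ℚ
... | yes p≡0 | _       = inj₁ p≡0
... | no  _   | yes q≡0 = inj₂ q≡0
... | no  p≢0 | no  q≢0 = ⊥-elim (x#0y#0→xy#0 p≢0 q≢0 pq≡0)

[x-a][x-b]≡0⇔x≡a⊎x≡b : ∀ x a b → (x - a) * (x - b) ≡ 0ℚ ⇔ (x ≡ a ⊎ x ≡ b)
[x-a][x-b]≡0⇔x≡a⊎x≡b x a b = mk⇔
  ([ inj₁ ∘ x∙y⁻¹≈ε⇒x≈y x a , inj₂ ∘ x∙y⁻¹≈ε⇒x≈y x b ] ∘ *≡0⇒≡0⊎≡0 (x - a) (x - b))
  [ (λ x≡a → trans (cong (_* (x - b)) (x≈y⇒x∙y⁻¹≈ε x≡a)) (*-zeroˡ (x - b)))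
  , (λ x≡b → trans (cong ((x - a) *_) (x≈y⇒x∙y⁻¹≈ε x≡b)) (*-zeroʳ (x - a))) ]

≡÷⇔*≡ : ∀ p q r (r≢0 : r ≢ 0ℚ) → p ≡ (q ÷ r) {{≢-nonZero r≢0}} ⇔ p * r ≡ q
≡÷⇔*≡ p q r r≢0 = mk⇔
  (λ p≡q÷r → begin
    p * r           ≡⟨ cong (_* r) p≡q÷r ⟩
    q * 1/ r * r    ≡⟨ *-assoc q (1/ r) r ⟩
    q * (1/ r * r)  ≡⟨ cong (q *_) (*-inverseˡ r) ⟩
    q * 1ℚ          ≡⟨ *-identityʳ q ⟩
    q               ∎)
  (λ pr≡q → begin
    p               ≡⟨ *-identityʳ p ⟨
    p * 1ℚ          ≡⟨ cong (p *_) (*-inverseʳ r) ⟨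
    p * (r * 1/ r)  ≡⟨ *-assoc p r (1/ r) ⟨
    p * r * 1/ r    ≡⟨ cong (_* 1/ r) pr≡q ⟩
    q * 1/ r        ∎)
  where instance _ = ≢-nonZero r≢0

*-cancelʳ-≢0 : ∀ p q r → r ≢ 0ℚ → p * r ≡ q * r → p ≡ q
*-cancelʳ-≢0 p q r r≢0 pr≡qr =
  trans (from (≡÷⇔*≡ p (q * r) r r≢0) pr≡qr) (sym (from (≡÷⇔*≡ q (q * r) r r≢0) refl))

Parametrises : ℚ → ℚ → Set
Parametrises s L = L * (2ℚ * s - 1ℚ) ≡ s * s - 1ℚ

≡formula⇔parametrises : ∀ L s (s≢½ : s ≢ ½ℚ) → L ≡ formula s s≢½ ⇔ Parametrises s L
≡formula⇔parametrises L s s≢½ = ≡÷⇔*≡ L (s * s - 1ℚ) (2ℚ * s - 1ℚ) (2s-1≢0 s s≢½)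

parametrises⇔square : ∀ s L → Parametrises s L ⇔ L * L - L + 1ℚ ≡ (s - L) * (s - L)
parametrises⇔square s L = a-b≡c-d⇒[a≡b⇔c≡d] (solve 2 (λ s L →
  L :* (con 2ℚ :* s :- con 1ℚ) :- (s :* s :- con 1ℚ)
    := (L :* L :- L :+ con 1ℚ) :- (s :- L) :* (s :- L)) refl s L)

parametrises⇒≢½ : ∀ s L → Parametrises s L → s ≢ ½ℚ
parametrises⇒≢½ s L param refl with trans (sym (*-zeroʳ L)) param
... | ()

parametrises⇒[≡⇔*≡] : ∀ s L → Parametrises s L →
  ∀ c → L ≡ c ⇔ s * s - 1ℚ ≡ c * (2ℚ * s - 1ℚ)
parametrises⇒[≡⇔*≡] s L param c = mk⇔
  (λ L≡c → trans (sym param) (cong (_* (2ℚ * s - 1ℚ)) L≡c))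
  (λ eq → *-cancelʳ-≢0 L c (2ℚ * s - 1ℚ) (2s-1≢0 s (parametrises⇒≢½ s L param)) (trans param eq))

parametrises⇒[≡0⇔≡±1] : ∀ s L → Parametrises s L → L ≡ 0ℚ ⇔ (s ≡ 1ℚ ⊎ s ≡ - 1ℚ)
parametrises⇒[≡0⇔≡±1] s L param =
  [x-a][x-b]≡0⇔x≡a⊎x≡b s 1ℚ (- 1ℚ) ⇔-∘ (a-b≡c-d⇒[a≡b⇔c≡d] (solve 1 (λ s →
    (s :* s :- con 1ℚ) :- con 0ℚ :* (con 2ℚ :* s :- con 1ℚ)
      := (s :- con 1ℚ) :* (s :- con (- 1ℚ)) :- con 0ℚ) refl s)
  ⇔-∘ parametrises⇒[≡⇔*≡] s L param 0ℚ)

parametrises⇒[≡1⇔≡0⊎≡2] : ∀ s L → Parametrises s L → L ≡ 1ℚ ⇔ (s ≡ 0ℚ ⊎ s ≡ 2ℚ)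
parametrises⇒[≡1⇔≡0⊎≡2] s L param =
  [x-a][x-b]≡0⇔x≡a⊎x≡b s 0ℚ 2ℚ ⇔-∘ (a-b≡c-d⇒[a≡b⇔c≡d] (solve 1 (λ s →
    (s :* s :- con 1ℚ) :- con 1ℚ :* (con 2ℚ :* s :- con 1ℚ)
      := (s :- con 0ℚ) :* (s :- con 2ℚ) :- con 0ℚ) refl s)
  ⇔-∘ parametrises⇒[≡⇔*≡] s L param 1ℚ)

lemma3p2 : (L : ℚ) →
    NiceEllipticCurve L ⇔
      (∃ λ s → Σ (s ≢ ½ℚ) λ s≢½ →
        (s ≢ 0ℚ) × (s ≢ 2ℚ) × (s ≢ 1ℚ) × (s ≢ - 1ℚ) × (L ≡ formula s s≢½))
lemma3p2 L = mk⇔ nice⇒parametrised parametrised⇒nice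
  where
  Parametrised : Set
  Parametrised = ∃ λ s → Σ (s ≢ ½ℚ) λ s≢½ →
    (s ≢ 0ℚ) × (s ≢ 2ℚ) × (s ≢ 1ℚ) × (s ≢ - 1ℚ) × (L ≡ formula s s≢½)

  nice⇒parametrised : NiceEllipticCurve L → Parametrised
  nice⇒parametrised (L≢0 , L≢1 , r , square) =
    s , s≢½ , L≢1 ∘ from L≡1 ∘ inj₁ , L≢1 ∘ from L≡1 ∘ inj₂ ,
        L≢0 ∘ from L≡0 ∘ inj₁ , L≢0 ∘ from L≡0 ∘ inj₂ ,
        from (≡formula⇔parametrises L s s≢½) param
    where
    s : ℚ
    s = L + r
    param : Parametrises s L
    param = from (parametrises⇔square s L)
      (trans square (cong (λ t → t * t) (solve 2 (λ L r → r := (L :+ r) :- L) refl L r)))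
    s≢½ : s ≢ ½ℚ
    s≢½ = parametrises⇒≢½ s L param
    L≡0 : L ≡ 0ℚ ⇔ (s ≡ 1ℚ ⊎ s ≡ - 1ℚ)
    L≡0 = parametrises⇒[≡0⇔≡±1] s L param
    L≡1 : L ≡ 1ℚ ⇔ (s ≡ 0ℚ ⊎ s ≡ 2ℚ)
    L≡1 = parametrises⇒[≡1⇔≡0⊎≡2] s L param

  parametrised⇒nice : Parametrised → NiceEllipticCurve L
  parametrised⇒nice (s , s≢½ , s≢0 , s≢2 , s≢1 , s≢-1 , L≡formula) =
    [ s≢1 , s≢-1 ] ∘ to (parametrises⇒[≡0⇔≡±1] s L param) ,
    [ s≢0 , s≢2 ] ∘ to (parametrises⇒[≡1⇔≡0⊎≡2] s L param) ,
    s - L , to (parametrises⇔square s L) param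
    where
    param : Parametrises s L
    param = to (≡formula⇔parametrises L s s≢½) L≡formula
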